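{- Let $X$ be a finite non-empty set and $R$ a monotone transit function on $X$ satisfying (uc): for all $x,y,u,v\in X$, if $R(x,y)\cap R(u,v)\neq\emptyset$ then there are $p,q\in R(x,y)\cup R(u,v)$ with $R(x,y)\cup R(u,v)=R(p,q)$. Let $u,v,s,t,w,r\in X$ be such that $R(u,v)$, $R(s,t)$ and $R(w,r)$ have pairwise non-empty intersections. Then $R(u,v)\cap R(s,t)\cap R(w,r)\neq\emptyset$.
   Context: A transit function on a finite non-empty set $X$ is a map $R:X\times X\to 2^X$ such that for all $u,v\in X$: $u\in R(u,v)$, $R(u,v)=R(v,u)$, and $R(u,u)=\{u\}$. $R$ is monotone if for all $u,v,p,q\in X$, $p,q\in R(u,v)$ implies $R(p,q)\subseteq R(u,v)$. -}

module Defs where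

open import Data.Nat using (ℕ)
open import Data.Fin using (Fin)
open import Data.Fin.Subset using (Subset; _∈_; _⊆_; _∩_; _∪_; ⁅_⁆; Nonempty)
open import Data.Product using (_×_; ∃; ∃₂; _,_)
open import Relation.Binary.PropositionalEquality using (_≡_)

-- The ground set X is modelled as Fin n; subsets of X as Subset n.
-- A map R : X × X → 2^X.
Map : ℕ → Set
Map n = Fin n → Fin n → Subset n

IsTransit : ∀ {n} → Map n → Set
IsTransit {n} R =
  (∀ (u v : Fin n) → u ∈ R u v) ×
  (∀ (u v : Fin n) → R u v ≡ R v u) ×
  (∀ (u : Fin n) → R u u ≡ ⁅ u ⁆)

Monotone : ∀ {n} → Map n → Set
Monotone {n} R = ∀ (u v p q : Fin n) → p ∈ R u v → q ∈ R u v → R p q ⊆ R u v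

UC : ∀ {n} → Map n → Set
UC {n} R = ∀ (x y u v : Fin n) → Nonempty (R x y ∩ R u v) →
  ∃₂ λ (p q : Fin n) → p ∈ (R x y ∪ R u v) × q ∈ (R x y ∪ R u v)
                      × (R x y ∪ R u v) ≡ R p q

{-# OPTIONS --safe #-}
-- Any three points a, b, c are in betweenness: one of them lies in the transit set of the
-- other two. Granting this, pick x ∈ R(u,v) ∩ R(s,t), y ∈ R(u,v) ∩ R(w,r) and
-- z ∈ R(s,t) ∩ R(w,r); if, say, x ∈ R(y,z), then monotonicity puts x in R(w,r) as well.
-- Betweenness comes from (uc) applied to R(a,b) and R(a,c), which meet at a: their union is
-- some R(p,q). Together with monotonicity this first gives R(b,c) ⊆ R(a,b) ∪ R(a,c); and if
-- c ∉ R(a,b) and b ∉ R(a,c), then p and q both lie in R(b,c), hence so does a ∈ R(p,q).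
module Submission where

open import Defs
open import Data.Nat using (ℕ; suc)
open import Data.Fin using (Fin)
open import Data.Fin.Subset using (_∈_; _∉_; _⊆_; _∩_; _∪_; Nonempty)
open import Data.Fin.Subset.Properties using (_∈?_; x∈p∩q⁺; x∈p∩q⁻; x∈p∪q⁺; x∈p∪q⁻)
open import Data.Product using (∃₂; _×_; _,_)
open import Data.Sum using (_⊎_; inj₁; inj₂)
open import Data.Empty using (⊥-elim)
open import Relation.Nullary using (yes; no)
open import Function using (case_of_)
open import Relation.Binary.PropositionalEquality using (_≡_; sym; subst)

module Betweenness {n : ℕ} {R : Map n}
  (∈R-left : ∀ u v → u ∈ R u v) (R-sym : ∀ u v → R u v ≡ R v u)
  (mono : Monotone R) (uc : UC R) where

  ∈R-sym : ∀ {x} u v → x ∈ R u v → x ∈ R v u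
  ∈R-sym u v = subst (_ ∈_) (R-sym u v)

  ∈R-right : ∀ u v → v ∈ R u v
  ∈R-right u v = ∈R-sym v u (∈R-left v u)

  ∪-span : ∀ a b c → ∃₂ λ p q →
    p ∈ R a b ∪ R a c × q ∈ R a b ∪ R a c × R a b ∪ R a c ≡ R p q
  ∪-span a b c = uc a b a c (a , x∈p∩q⁺ (∈R-left a b , ∈R-left a c))

  R⊆R∪R : ∀ x y z → R y z ⊆ R x y ∪ R x z
  R⊆R∪R x y z e∈Ryz with ∪-span x y z
  ... | p , q , _ , _ , U≡Rpq =
    subst (_ ∈_) (sym U≡Rpq) (mono p q y z (toRpq y∈U) (toRpq z∈U) e∈Ryz)
    where
    toRpq : ∀ {e} → e ∈ R x y ∪ R x z → e ∈ R p q
    toRpq = subst (_ ∈_) U≡Rpq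
    y∈U : y ∈ R x y ∪ R x z
    y∈U = x∈p∪q⁺ (inj₁ (∈R-right x y))
    z∈U : z ∈ R x y ∪ R x z
    z∈U = x∈p∪q⁺ (inj₂ (∈R-right x z))

  ∈R∖R⇒∈R : ∀ {x} a b c → x ∈ R a b → x ∉ R a c → x ∈ R b c
  ∈R∖R⇒∈R a b c x∈ab x∉ac with x∈p∪q⁻ (R c a) (R c b) (R⊆R∪R c a b x∈ab)
  ... | inj₁ x∈ca = ⊥-elim (x∉ac (∈R-sym c a x∈ca))
  ... | inj₂ x∈cb = ∈R-sym c b x∈cb

  ∈∪∖∩⇒∈R : ∀ {x} a b c → x ∈ R a b ∪ R a c → x ∉ R a b ∩ R a c → x ∈ R b c
  ∈∪∖∩⇒∈R a b c x∈U x∉∩ with x∈p∪q⁻ (R a b) (R a c) x∈U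
  ... | inj₁ x∈ab = ∈R∖R⇒∈R a b c x∈ab (λ x∈ac → x∉∩ (x∈p∩q⁺ (x∈ab , x∈ac)))
  ... | inj₂ x∈ac = ∈R-sym c b (∈R∖R⇒∈R a c b x∈ac (λ x∈ab → x∉∩ (x∈p∩q⁺ (x∈ab , x∈ac))))

  ∉R∧∉R⇒∈R : ∀ a b c → c ∉ R a b → b ∉ R a c → a ∈ R b c
  ∉R∧∉R⇒∈R a b c c∉ab b∉ac with ∪-span a b c
  ... | p , q , p∈U , q∈U , U≡Rpq =
    U⊆R (∈∪∖∩⇒∈R a b c p∈U (endpoint∉∩ U⊆R q∈U))
        (∈∪∖∩⇒∈R a b c q∈U (endpoint∉∩ (λ q∈ p∈ → U⊆R p∈ q∈) p∈U))
        (x∈p∪q⁺ (inj₁ (∈R-left a b)))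
    where
    U⊆R : ∀ {x y} → p ∈ R x y → q ∈ R x y → R a b ∪ R a c ⊆ R x y
    U⊆R p∈ q∈ e∈U = mono _ _ p q p∈ q∈ (subst (_ ∈_) U≡Rpq e∈U)
    -- Whichever of R(a,b), R(a,c) contains f would contain both endpoints, hence c resp. b.
    endpoint∉∩ : ∀ {e f} → (∀ {x y} → e ∈ R x y → f ∈ R x y → R a b ∪ R a c ⊆ R x y) →
      f ∈ R a b ∪ R a c → e ∉ R a b ∩ R a c
    endpoint∉∩ span⊆R f∈U e∈∩ with x∈p∩q⁻ (R a b) (R a c) e∈∩ | x∈p∪q⁻ (R a b) (R a c) f∈U
    ... | e∈ab , _ | inj₁ f∈ab = c∉ab (span⊆R e∈ab f∈ab (x∈p∪q⁺ (inj₂ (∈R-right a c))))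
    ... | _ , e∈ac | inj₂ f∈ac = b∉ac (span⊆R e∈ac f∈ac (x∈p∪q⁺ (inj₁ (∈R-right a b))))

  betweenness : ∀ a b c → a ∈ R b c ⊎ b ∈ R a c ⊎ c ∈ R a b
  betweenness a b c with c ∈? R a b | b ∈? R a c
  ... | yes c∈ab | _         = inj₂ (inj₂ c∈ab)
  ... | no _     | yes b∈ac  = inj₂ (inj₁ b∈ac)
  ... | no c∉ab  | no b∉ac   = inj₁ (∉R∧∉R⇒∈R a b c c∉ab b∉ac)

lemma6 : ∀ (m : ℕ) (R : Map (suc m)) → IsTransit R → Monotone R → UC R →
    ∀ (u v s t w r : Fin (suc m)) →
    Nonempty (R u v ∩ R s t) → Nonempty (R u v ∩ R w r) → Nonempty (R s t ∩ R w r) →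
    Nonempty (R u v ∩ R s t ∩ R w r)
lemma6 m R (∈R-left , R-sym , _) mono uc u v s t w r (x , x∈uv∩st) (y , y∈uv∩wr) (z , z∈st∩wr) =
  let x∈uv , x∈st = x∈p∩q⁻ (R u v) (R s t) x∈uv∩st
      y∈uv , y∈wr = x∈p∩q⁻ (R u v) (R w r) y∈uv∩wr
      z∈st , z∈wr = x∈p∩q⁻ (R s t) (R w r) z∈st∩wr
  in case betweenness x y z of λ where
       (inj₁ x∈yz) → x , x∈p∩q⁺ (x∈uv , x∈p∩q⁺ (x∈st , mono w r y z y∈wr z∈wr x∈yz))
       (inj₂ (inj₁ y∈xz)) → y , x∈p∩q⁺ (y∈uv , x∈p∩q⁺ (mono s t x z x∈st z∈st y∈xz , y∈wr))
       (inj₂ (inj₂ z∈xy)) → z , x∈p∩q⁺ (mono u v x y x∈uv y∈uv z∈xy , x∈p∩q⁺ (z∈st , z∈wr))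
  where open Betweenness ∈R-left R-sym mono uc
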